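{- Let $H$ be a complete multipartite graph with at least three parts such that at least two of its parts have more than one vertex. If $H'$ is a connected cograph obtained from $H$ by adding one new vertex (i.e., $H'$ has a vertex $x$ with $H' - x = H$), then exactly one of the following holds: (1) $H'$ is a complete multipartite graph; (2) $H'$ contains at least one of $K_1 \oplus (K_1 + C_4)$, $\overline{K_2} \oplus (K_1 + P_3)$, or $K_1 \oplus \overline{P_3 + K_2}$ as an induced subgraph.
   Context: All graphs are finite and simple. A cograph is a graph with no induced subgraph isomorphic to $P_4$. $G+H$ denotes disjoint union, $G \oplus H$ the join (disjoint union plus all edges between $G$ and $H$), $\overline{G}$ the complement; $K_n$, $P_n$, $C_n$ are the complete graph, path and cycle on $n$ vertices. -}

module Defs where

open import Data.Nat using (ℕ; suc; _+_; _∸_; _≡ᵇ_; _≤ᵇ_; _≤_)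
open import Data.Fin using (Fin; toℕ; splitAt; punchIn; _≟_)
open import Data.Bool using (Bool; true; false; not; _∧_; _∨_)
open import Data.Sum using (_⊎_; inj₁; inj₂)
open import Data.Product using (Σ; ∃; _×_; _,_)
open import Relation.Nullary using (¬_)
open import Relation.Nullary.Decidable using (⌊_⌋)
open import Relation.Binary.PropositionalEquality using (_≡_; _≢_)
open import Function.Definitions using (Injective; Surjective)
open import Function.Bundles using (_⇔_)

Graph : ℕ → Set
Graph n = Fin n → Fin n → Bool

IsSimple : ∀ {n} → Graph n → Set
IsSimple G = (∀ u v → G u v ≡ G v u) × (∀ u → G u u ≡ false)

K : (n : ℕ) → Graph n
K n i j = not ⌊ i ≟ j ⌋

P : (n : ℕ) → Graph n
P n i j = (suc (toℕ i) ≡ᵇ toℕ j) ∨ (suc (toℕ j) ≡ᵇ toℕ i)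

C : (n : ℕ) → Graph n
C n i j = P n i j ∨ ((3 ≤ᵇ n) ∧
  (((toℕ i ≡ᵇ 0) ∧ (toℕ j ≡ᵇ (n ∸ 1))) ∨ ((toℕ j ≡ᵇ 0) ∧ (toℕ i ≡ᵇ (n ∸ 1)))))

co : ∀ {n} → Graph n → Graph n
co G i j = not (G i j) ∧ not ⌊ i ≟ j ⌋

_⊞_ : ∀ {m n} → Graph m → Graph n → Graph (m + n)
_⊞_ {m} G H i j with splitAt m i | splitAt m j
... | inj₁ a | inj₁ b = G a b
... | inj₂ a | inj₂ b = H a b
... | inj₁ _ | inj₂ _ = false
... | inj₂ _ | inj₁ _ = false

_⊕_ : ∀ {m n} → Graph m → Graph n → Graph (m + n)
_⊕_ {m} G H i j with splitAt m i | splitAt m j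
... | inj₁ a | inj₁ b = G a b
... | inj₂ a | inj₂ b = H a b
... | inj₁ _ | inj₂ _ = true
... | inj₂ _ | inj₁ _ = true

InducedSub : ∀ {m n} → Graph m → Graph n → Set
InducedSub {m} {n} F G =
  Σ (Fin m → Fin n) λ φ → Injective _≡_ _≡_ φ × (∀ a b → G (φ a) (φ b) ≡ F a b)

IsCograph : ∀ {n} → Graph n → Set
IsCograph G = ¬ InducedSub (P 4) G

data Reachable {n} (G : Graph n) : Fin n → Fin n → Set where
  here : ∀ {u} → Reachable G u u
  step : ∀ {u w v} → G u w ≡ true → Reachable G w v → Reachable G u v

Connected : ∀ {n} → Graph n → Set
Connected G = ∀ u v → Reachable G u v

IsCMPartition : ∀ {n} → Graph n → (k : ℕ) → (Fin n → Fin k) → Set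
IsCMPartition G k f = Surjective _≡_ _≡_ f × (∀ u v → (G u v ≡ true) ⇔ (f u ≢ f v))

IsCompleteMultipartite : ∀ {n} → Graph n → Set
IsCompleteMultipartite {n} G = Σ ℕ λ k → Σ (Fin n → Fin k) λ f → IsCMPartition G k f

IsLemma10Host : ∀ {n} → Graph n → Set
IsLemma10Host {n} G = Σ ℕ λ k → Σ (Fin n → Fin k) λ f → IsCMPartition G k f × (3 ≤ k) ×
  (Σ (Fin k) λ p → Σ (Fin k) λ q → p ≢ q ×
     (Σ (Fin n) λ a → Σ (Fin n) λ b → a ≢ b × f a ≡ p × f b ≡ p) ×
     (Σ (Fin n) λ c → Σ (Fin n) λ d → c ≢ d × f c ≡ q × f d ≡ q))

F₁ : Graph 6
F₁ = K 1 ⊕ (K 1 ⊞ C 4)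

F₂ : Graph 6
F₂ = co (K 2) ⊕ (K 1 ⊞ P 3)

F₃ : Graph 6
F₃ = K 1 ⊕ co (P 3 ⊞ K 2)

ContainsForbidden : ∀ {n} → Graph n → Set
ContainsForbidden G = InducedSub F₁ G ⊎ InducedSub F₂ G ⊎ InducedSub F₃ G

{-# OPTIONS --safe #-}
-- Write H = H' - x with parts f, and let N and M be the neighbours and non-neighbours of x
-- in H. If M is empty, x forms a new part; if M is exactly one part, x joins it. If x splits
-- a part Q, it sees everything outside Q (otherwise x, a seen vertex of Q, a missed vertex
-- outside Q and a missed vertex of Q induce a P₄), and a large part other than Q together
-- with a vertex of a third part gives K₁ ⊕ co(P₃ + K₂). If M meets two parts, the same P₄
-- argument makes M a union of parts, and the two large parts of H, each wholly missed or
-- wholly seen, give one of the three forbidden graphs. Conversely every forbidden graph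
-- contains an induced K₁ + K₂, which a complete multipartite graph cannot contain because
-- non-adjacency is transitive there.
module Submission where

open import Defs
open import Data.Nat using (ℕ; suc; _≤_; s≤s; s<s⁻¹)
open import Data.Fin using (Fin; zero; suc; _<_; _≟_; #_; punchIn; punchOut)
open import Data.Fin.Properties
  using (all?; any?; <-cmp; suc-injective; punchIn-injective; punchInᵢ≢i; punchIn-punchOut)
open import Data.Bool using (true; false)
import Data.Bool.Properties as Bool
open import Data.List using (List; []; _∷_)
open import Data.List.Membership.Propositional using (_∈_)
import Data.List.Membership.DecPropositional as DecMembership
open import Data.List.Relation.Unary.All as All using (All; []; _∷_)
open import Data.Product using (Σ; ∃; _×_; _,_; proj₁; proj₂)
open import Data.Product.Properties using (≡-dec)
open import Data.Sum using (_⊎_; inj₁; inj₂)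
open import Data.Vec using (Vec; []; _∷_; lookup; tabulate; allFin)
open import Data.Vec.Functional.Properties using (insertAt-lookup; insertAt-punchIn)
open import Data.Vec.Functional using (insertAt)
open import Data.Vec.Relation.Unary.AllPairs using (AllPairs; []; _∷_)
open import Data.Vec.Relation.Unary.All using ([]; _∷_)
import Data.Vec.Relation.Unary.All.Properties as VecAll
open import Data.Empty using (⊥-elim)
open import Function using (_∘_)
open import Function.Bundles using (_⇔_; mk⇔; Equivalence)
open import Function.Definitions using (Surjective)
open import Relation.Binary using (Rel; tri<; tri≈; tri>)
open import Relation.Nullary using (Dec; yes; no; ¬_)
open import Relation.Nullary.Decidable using (from-yes; ¬?; _×-dec_; _⊎-dec_; _→-dec_)
open import Relation.Binary.PropositionalEquality
  using (_≡_; _≢_; refl; sym; trans; cong; subst; ≢-sym)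

open Equivalence using (to; from)

allPairs-tabulate⁻ : ∀ {a ℓ} {A : Set a} {R : Rel A ℓ} {m} {f : Fin m → A} →
  AllPairs R (tabulate f) → ∀ {i j} → i < j → R (f i) (f j)
allPairs-tabulate⁻ (Rf₀ ∷ _)  {zero}  {suc j} _   = VecAll.tabulate⁻ Rf₀ j
allPairs-tabulate⁻ (_ ∷ Rfs) {suc i} {suc j} i<j = allPairs-tabulate⁻ Rfs (s<s⁻¹ i<j)

third-element : ∀ {k} → 3 ≤ k → (i j : Fin k) → ∃ λ r → r ≢ i × r ≢ j
third-element (s≤s (s≤s (s≤s _))) zero          zero          = # 1 , (λ ()) , (λ ())
third-element (s≤s (s≤s (s≤s _))) zero          (suc zero)    = # 2 , (λ ()) , (λ ())
third-element (s≤s (s≤s (s≤s _))) zero          (suc (suc _)) = # 1 , (λ ()) , (λ ())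
third-element (s≤s (s≤s (s≤s _))) (suc zero)    zero          = # 2 , (λ ()) , (λ ())
third-element (s≤s (s≤s (s≤s _))) (suc zero)    (suc _)       = # 0 , (λ ()) , (λ ())
third-element (s≤s (s≤s (s≤s _))) (suc (suc _)) zero          = # 1 , (λ ()) , (λ ())
third-element (s≤s (s≤s (s≤s _))) (suc (suc _)) (suc _)       = # 0 , (λ ()) , (λ ())

data PunchView {n} (i : Fin (suc n)) : Fin (suc n) → Set where
  pivot   : PunchView i i
  punched : (j : Fin n) → PunchView i (punchIn i j)

punchView : ∀ {n} (i v : Fin (suc n)) → PunchView i v
punchView i v with i ≟ v
... | yes refl = pivot
... | no i≢v   = subst (PunchView i) (punchIn-punchOut i≢v) (punched (punchOut i≢v))

reachable⇒neighbour : ∀ {n} {G : Graph n} {u v} → Reachable G u v → u ≢ v →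
  ∃ λ w → G u w ≡ true
reachable⇒neighbour here                u≢u = ⊥-elim (u≢u refl)
reachable⇒neighbour (step {w = w} uw _) _ = w , uw

Twins : ∀ {m} → Graph m → Fin m → Fin m → Set
Twins F i j = ∀ l → F i l ≡ F j l

TwinsAmong : ∀ {m} → Graph m → List (Fin m × Fin m) → Set
TwinsAmong F L = ∀ i j → Twins F i j → i ≡ j ⊎ (i , j) ∈ L ⊎ (j , i) ∈ L

twinsAmong? : ∀ {m} (F : Graph m) L → Dec (TwinsAmong F L)
twinsAmong? F L = all? λ i → all? λ j →
  (all? λ l → F i l Bool.≟ F j l) →-dec (i ≟ j ⊎-dec ((i , j) ∈? L ⊎-dec (j , i) ∈? L))
  where open DecMembership (≡-dec _≟_ _≟_) using (_∈?_)

simple? : ∀ {m} (F : Graph m) → Dec (IsSimple F)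
simple? F = (all? λ i → all? λ j → F i j Bool.≟ F j i) ×-dec (all? λ i → F i i Bool.≟ false)

Spans : ∀ {n m} → Graph n → Graph m → Vec (Fin n) m → Set
Spans {m = m} G F vs = AllPairs (λ i j → G (lookup vs i) (lookup vs j) ≡ F i j) (allFin m)

module InducedCopies {n} {G : Graph n} (G-simple : IsSimple G) where

  G-sym : ∀ u v → G u v ≡ G v u
  G-sym = proj₁ G-simple

  G-irr : ∀ u → G u u ≡ false
  G-irr = proj₂ G-simple

  spans⇒agrees : ∀ {m} {F : Graph m} → IsSimple F → (vs : Vec (Fin n) m) → Spans G F vs →
    ∀ i j → G (lookup vs i) (lookup vs j) ≡ F i j
  spans⇒agrees (F-sym , F-irr) vs spans i j with <-cmp i j
  ... | tri< i<j _ _ = allPairs-tabulate⁻ spans i<j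
  ... | tri≈ _ refl _ = trans (G-irr (lookup vs i)) (sym (F-irr i))
  ... | tri> _ _ j<i = trans (G-sym _ _) (trans (allPairs-tabulate⁻ spans j<i) (F-sym j i))

  -- Indices with equal images are twins in F, so only the listed twin pairs need distinct images.
  induced-copy : ∀ {m} {F : Graph m} {L} → IsSimple F → TwinsAmong F L →
    (vs : Vec (Fin n) m) → Spans G F vs → All (λ (i , j) → lookup vs i ≢ lookup vs j) L →
    InducedSub F G
  induced-copy {F = F} F-simple twins vs spans distinct = lookup vs , injective , agrees
    where
    agrees : ∀ i j → G (lookup vs i) (lookup vs j) ≡ F i j
    agrees = spans⇒agrees F-simple vs spans

    same-image⇒twins : ∀ {i j} → lookup vs i ≡ lookup vs j → Twins F i j
    same-image⇒twins {i} {j} same l =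
      trans (sym (agrees i l)) (trans (cong (λ v → G v (lookup vs l)) same) (agrees j l))

    injective : ∀ {i j} → lookup vs i ≡ lookup vs j → i ≡ j
    injective {i} {j} same with twins i j (same-image⇒twins same)
    ... | inj₁ i≡j          = i≡j
    ... | inj₂ (inj₁ ij∈L) = ⊥-elim (All.lookup distinct ij∈L same)
    ... | inj₂ (inj₂ ji∈L) = ⊥-elim (All.lookup distinct ji∈L (sym same))

  P₄-copy : (vs : Vec (Fin n) 4) → Spans G (P 4) vs → InducedSub (P 4) G
  P₄-copy vs spans =
    induced-copy (from-yes (simple? (P 4))) (from-yes (twinsAmong? (P 4) [])) vs spans []

  F₁-copy : (vs : Vec (Fin n) 6) → Spans G F₁ vs →
    lookup vs (# 2) ≢ lookup vs (# 4) → lookup vs (# 3) ≢ lookup vs (# 5) → InducedSub F₁ G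
  F₁-copy vs spans d₂₄ d₃₅ =
    induced-copy (from-yes (simple? F₁)) (from-yes (twinsAmong? F₁ ((# 2 , # 4) ∷ (# 3 , # 5) ∷ [])))
      vs spans (d₂₄ ∷ d₃₅ ∷ [])

  F₂-copy : (vs : Vec (Fin n) 6) → Spans G F₂ vs →
    lookup vs (# 0) ≢ lookup vs (# 1) → lookup vs (# 3) ≢ lookup vs (# 5) → InducedSub F₂ G
  F₂-copy vs spans d₀₁ d₃₅ =
    induced-copy (from-yes (simple? F₂)) (from-yes (twinsAmong? F₂ ((# 0 , # 1) ∷ (# 3 , # 5) ∷ [])))
      vs spans (d₀₁ ∷ d₃₅ ∷ [])

  F₃-copy : (vs : Vec (Fin n) 6) → Spans G F₃ vs →
    lookup vs (# 4) ≢ lookup vs (# 5) → InducedSub F₃ G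
  F₃-copy vs spans d₄₅ =
    induced-copy (from-yes (simple? F₃)) (from-yes (twinsAmong? F₃ ((# 4 , # 5) ∷ [])))
      vs spans (d₄₅ ∷ [])

module Partition {n k} {G : Graph n} {f : Fin n → Fin k}
  (partition : ∀ u v → (G u v ≡ true) ⇔ (f u ≢ f v)) where

  apart⇒adjacent : ∀ {u v} → f u ≢ f v → G u v ≡ true
  apart⇒adjacent = from (partition _ _)

  together⇒nonadjacent : ∀ {u v} → f u ≡ f v → G u v ≡ false
  together⇒nonadjacent fu≡fv = Bool.¬-not λ uv → to (partition _ _) uv fu≡fv

  nonadjacent⇒together : ∀ {u v} → G u v ≡ false → f u ≡ f v
  nonadjacent⇒together {u} {v} uv with f u ≟ f v
  ... | yes fu≡fv = fu≡fv
  ... | no fu≢fv  = ⊥-elim (Bool.not-¬ (apart⇒adjacent fu≢fv) uv)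

cm-nonadjacent-trans : ∀ {n} {G : Graph n} → IsCompleteMultipartite G →
  ∀ {a b c} → G a b ≡ false → G b c ≡ false → G a c ≡ false
cm-nonadjacent-trans (_ , _ , _ , partition) ab bc =
  together⇒nonadjacent (trans (nonadjacent⇒together ab) (nonadjacent⇒together bc))
  where open Partition partition

induced-K₁+K₂⇒¬cm : ∀ {m n} {F : Graph m} {G : Graph n} → InducedSub F G →
  ∀ i j l → F i j ≡ false → F j l ≡ false → F i l ≡ true → ¬ IsCompleteMultipartite G
induced-K₁+K₂⇒¬cm (_ , _ , agrees) i j l ij jl il cm =
  Bool.not-¬ (trans (agrees i l) il)
    (cm-nonadjacent-trans cm (trans (agrees i j) ij) (trans (agrees j l) jl))

forbidden⇒¬cm : ∀ {n} {G : Graph n} → ContainsForbidden G → ¬ IsCompleteMultipartite G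
forbidden⇒¬cm (inj₁ copy)        = induced-K₁+K₂⇒¬cm copy (# 2) (# 1) (# 3) refl refl refl
forbidden⇒¬cm (inj₂ (inj₁ copy)) = induced-K₁+K₂⇒¬cm copy (# 3) (# 2) (# 4) refl refl refl
forbidden⇒¬cm (inj₂ (inj₂ copy)) = induced-K₁+K₂⇒¬cm copy (# 1) (# 2) (# 3) refl refl refl

module Extension {n k} {G : Graph (suc n)} (x : Fin (suc n)) (G-simple : IsSimple G)
  (cograph : IsCograph G) {f : Fin n → Fin k} (f-surjective : Surjective _≡_ _≡_ f)
  (partition : ∀ u v → (G (punchIn x u) (punchIn x v) ≡ true) ⇔ (f u ≢ f v)) where

  open InducedCopies G-simple
  open Partition partition

  ι : Fin n → Fin (suc n)
  ι = punchIn x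

  ι-≢ : ∀ {u v} → u ≢ v → ι u ≢ ι v
  ι-≢ u≢v = u≢v ∘ punchIn-injective x _ _

  N M : Fin n → Set
  N u = G x (ι u) ≡ true
  M u = G x (ι u) ≡ false

  M? : ∀ u → Dec (M u)
  M? u = G x (ι u) Bool.≟ false

  N? : ∀ u → Dec (N u)
  N? u = G x (ι u) Bool.≟ true

  N⇒¬M : ∀ {u} → N u → ¬ M u
  N⇒¬M = Bool.not-¬

  ¬M⇒N : ∀ {u} → ¬ M u → N u
  ¬M⇒N = Bool.¬-not

  ¬N⇒M : ∀ {u} → ¬ N u → M u
  ¬N⇒M = Bool.¬-not

  N-sym : ∀ {u} → N u → G (ι u) x ≡ true
  N-sym = trans (G-sym _ _)

  M-sym : ∀ {u} → M u → G (ι u) x ≡ false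
  M-sym = trans (G-sym _ _)

  across : ∀ {u v P R} → f u ≡ P → f v ≡ R → P ≢ R → G (ι u) (ι v) ≡ true
  across fu fv P≢R = apart⇒adjacent λ fu≡fv → P≢R (trans (sym fu) (trans fu≡fv fv))

  within : ∀ {u v P} → f u ≡ P → f v ≡ P → G (ι u) (ι v) ≡ false
  within fu fv = together⇒nonadjacent (trans fu (sym fv))

  x-has-neighbour : Connected G → Fin n → ∃ N
  x-has-neighbour connected u
    with reachable⇒neighbour (connected x (ι u)) (≢-sym (punchInᵢ≢i x u))
  ... | w , xw with punchView x w
  ...   | pivot     = ⊥-elim (Bool.not-¬ xw (G-irr x))
  ...   | punched v = v , xw

  extended-partition⇒cm : ∀ {K} (c : Fin K) (h : Fin n → Fin K) →
    (∀ j → c ≡ j ⊎ ∃ λ u → h u ≡ j) → (∀ u → N u ⇔ (c ≢ h u)) →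
    (∀ u v → (G (ι u) (ι v) ≡ true) ⇔ (h u ≢ h v)) → IsCompleteMultipartite G
  extended-partition⇒cm {K} c h covers x-adjacency adjacency = K , g , surjective , g-adjacency
    where
    g : Fin (suc n) → Fin K
    g = insertAt h x c

    surjective : Surjective _≡_ _≡_ g
    surjective j with covers j
    ... | inj₁ c≡j       = x , λ { refl → trans (insertAt-lookup h x c) c≡j }
    ... | inj₂ (u , hu≡j) = ι u , λ { refl → trans (insertAt-punchIn h x c u) hu≡j }

    transpose : ∀ {v w a b} → (G v w ≡ true) ⇔ (a ≢ b) → (G w v ≡ true) ⇔ (b ≢ a)
    transpose vw = mk⇔ (λ wv → ≢-sym (to vw (trans (G-sym _ _) wv)))
                  (λ b≢a → trans (G-sym _ _) (from vw (≢-sym b≢a)))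

    g-adjacency : ∀ v w → (G v w ≡ true) ⇔ (g v ≢ g w)
    g-adjacency v w with punchView x v | punchView x w
    ... | pivot | pivot =
      mk⇔ (λ xx → ⊥-elim (Bool.not-¬ xx (G-irr x))) (λ c≢c → ⊥-elim (c≢c refl))
    ... | pivot | punched u
      rewrite insertAt-lookup h x c | insertAt-punchIn h x c u = x-adjacency u
    ... | punched u | pivot
      rewrite insertAt-lookup h x c | insertAt-punchIn h x c u = transpose (x-adjacency u)
    ... | punched u | punched u′
      rewrite insertAt-punchIn h x c u | insertAt-punchIn h x c u′ = adjacency u u′

  universal⇒cm : (∀ u → N u) → IsCompleteMultipartite G
  universal⇒cm all-N = extended-partition⇒cm zero (suc ∘ f) covers
    (λ u → mk⇔ (λ _ ()) (λ _ → all-N u))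
    (λ u v → mk⇔ (λ uv → to (partition u v) uv ∘ suc-injective)
                 (λ s≢s → from (partition u v) (s≢s ∘ cong suc)))
    where
    covers : ∀ j → zero ≡ j ⊎ ∃ λ u → suc (f u) ≡ j
    covers zero    = inj₁ refl
    covers (suc j) = inj₂ (proj₁ (f-surjective j) , cong suc (proj₂ (f-surjective j) refl))

  joins-part⇒cm : (Q : Fin k) → (∀ u → N u ⇔ (Q ≢ f u)) → IsCompleteMultipartite G
  joins-part⇒cm Q x-adjacency = extended-partition⇒cm Q f
    (λ j → inj₂ (proj₁ (f-surjective j) , proj₂ (f-surjective j) refl)) x-adjacency partition

  -- Otherwise x, b, c, a would be an induced P₄.
  split⇒N-outside : ∀ {a b c} → M a → N b → f a ≡ f b → f c ≢ f a → N c
  split⇒N-outside {a} {b} {c} ma nb fa≡fb fc≢fa =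
    ¬M⇒N λ mc → cograph (P₄-copy (x ∷ ι b ∷ ι c ∷ ι a ∷ [])
      ( (nb ∷ mc ∷ ma ∷ [])
      ∷ (across refl refl (λ e → fc≢fa (trans (sym e) (sym fa≡fb))) ∷ within refl fa≡fb ∷ [])
      ∷ (across refl refl fc≢fa ∷ [])
      ∷ [] ∷ []))

  Large Missed Seen : Fin k → Set
  Large P  = Σ (Fin n) λ a → Σ (Fin n) λ b → a ≢ b × f a ≡ P × f b ≡ P
  Missed P = ∀ {u} → f u ≡ P → M u
  Seen P   = ∀ {u} → f u ≡ P → N u

  seen-outside : ∀ {P u} → Seen P → M u → f u ≢ P
  seen-outside seen mu fu = N⇒¬M (seen fu) mu

  missed-outside : ∀ {P u} → Missed P → N u → f u ≢ P
  missed-outside missed nu fu = N⇒¬M nu (missed fu)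

  split⇒forbidden : ∀ {u₀ u₁ P R e} → M u₀ → N u₁ → f u₁ ≡ f u₀ → (∀ v → f v ≢ f u₀ → N v) →
    Large P → P ≢ f u₀ → f e ≡ R → R ≢ f u₀ → R ≢ P → ContainsForbidden G
  split⇒forbidden {u₀} {u₁} {e = e} m₀ n₁ fu₁ outside (c , d , c≢d , fc , fd)
    P≢Q fe R≢Q R≢P =
    inj₂ (inj₂ (F₃-copy (ι e ∷ x ∷ ι u₀ ∷ ι u₁ ∷ ι c ∷ ι d ∷ [])
      ( (N-sym (seen fe R≢Q) ∷ across fe refl R≢Q ∷ across fe fu₁ R≢Q
        ∷ across fe fc R≢P ∷ across fe fd R≢P ∷ [])
      ∷ (m₀ ∷ n₁ ∷ seen fc P≢Q ∷ seen fd P≢Q ∷ [])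
      ∷ (within refl fu₁ ∷ across refl fc (≢-sym P≢Q) ∷ across refl fd (≢-sym P≢Q) ∷ [])
      ∷ (across fu₁ fc (≢-sym P≢Q) ∷ across fu₁ fd (≢-sym P≢Q) ∷ [])
      ∷ (within fc fd ∷ [])
      ∷ [] ∷ [])
      (ι-≢ c≢d)))
    where
    seen : ∀ {v S} → f v ≡ S → S ≢ f u₀ → N v
    seen fv S≢Q = outside _ λ e → S≢Q (trans (sym fv) e)

  missed-missed⇒forbidden : ∀ {P R z} → Large P → Large R → P ≢ R → Missed P → Missed R → N z →
    ContainsForbidden G
  missed-missed⇒forbidden {P} {R} {z} (a , b , a≢b , fa , fb) (c , d , c≢d , fc , fd)
    P≢R missed-P missed-R nz =
    inj₁ (F₁-copy (ι z ∷ x ∷ ι a ∷ ι c ∷ ι b ∷ ι d ∷ [])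
      ( (N-sym nz ∷ across refl fa z∉P ∷ across refl fc z∉R
        ∷ across refl fb z∉P ∷ across refl fd z∉R ∷ [])
      ∷ (missed-P fa ∷ missed-R fc ∷ missed-P fb ∷ missed-R fd ∷ [])
      ∷ (across fa fc P≢R ∷ within fa fb ∷ across fa fd P≢R ∷ [])
      ∷ (across fc fb (≢-sym P≢R) ∷ within fc fd ∷ [])
      ∷ (across fb fd P≢R ∷ [])
      ∷ [] ∷ [])
      (ι-≢ a≢b) (ι-≢ c≢d))
    where
    z∉P : f z ≢ P
    z∉P = missed-outside missed-P nz

    z∉R : f z ≢ R
    z∉R = missed-outside missed-R nz

  missed-seen⇒forbidden : ∀ {P R m} → Large P → Large R → P ≢ R → Missed P → Seen R →
    M m → f m ≢ P → ContainsForbidden G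
  missed-seen⇒forbidden {P} {R} {m} (a , b , a≢b , fa , fb) (c , d , c≢d , fc , fd)
    P≢R missed-P seen-R mm m∉P =
    inj₂ (inj₁ (F₂-copy (ι c ∷ ι d ∷ x ∷ ι a ∷ ι m ∷ ι b ∷ [])
      ( (within fc fd ∷ N-sym (seen-R fc) ∷ across fc fa R≢P
        ∷ across fc refl R≢m ∷ across fc fb R≢P ∷ [])
      ∷ (N-sym (seen-R fd) ∷ across fd fa R≢P ∷ across fd refl R≢m ∷ across fd fb R≢P ∷ [])
      ∷ (missed-P fa ∷ mm ∷ missed-P fb ∷ [])
      ∷ (across fa refl (≢-sym m∉P) ∷ within fa fb ∷ [])
      ∷ (across refl fb m∉P ∷ [])
      ∷ [] ∷ [])
      (ι-≢ c≢d) (ι-≢ a≢b)))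
    where
    R≢P : R ≢ P
    R≢P = ≢-sym P≢R

    R≢m : R ≢ f m
    R≢m = ≢-sym (seen-outside seen-R mm)

  seen-seen⇒forbidden : ∀ {P R u₀ w} → Large P → Large R → P ≢ R → Seen P → Seen R →
    M u₀ → M w → f w ≢ f u₀ → ContainsForbidden G
  seen-seen⇒forbidden {P} {R} {u₀} {w} (a , b , a≢b , fa , fb) (c , _ , _ , fc , _)
    P≢R seen-P seen-R m₀ m_w w∉Q =
    inj₂ (inj₂ (F₃-copy (ι c ∷ ι u₀ ∷ x ∷ ι w ∷ ι a ∷ ι b ∷ [])
      ( (across fc refl (≢-sym (seen-outside seen-R m₀)) ∷ N-sym (seen-R fc)
        ∷ across fc refl (≢-sym (seen-outside seen-R m_w))
        ∷ across fc fa R≢P ∷ across fc fb R≢P ∷ [])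
      ∷ (M-sym m₀ ∷ across refl refl (≢-sym w∉Q)
        ∷ across refl fa u₀∉P ∷ across refl fb u₀∉P ∷ [])
      ∷ (m_w ∷ seen-P fa ∷ seen-P fb ∷ [])
      ∷ (across refl fa w∉P ∷ across refl fb w∉P ∷ [])
      ∷ (within fa fb ∷ [])
      ∷ [] ∷ [])
      (ι-≢ a≢b)))
    where
    R≢P : R ≢ P
    R≢P = ≢-sym P≢R

    u₀∉P : f u₀ ≢ P
    u₀∉P = seen-outside seen-P m₀

    w∉P : f w ≢ P
    w∉P = seen-outside seen-P m_w

  -- A split part would force x to see u₀ or w.
  missed-twice⇒closed : ∀ {u₀ w} → M u₀ → M w → f w ≢ f u₀ → ∀ {u v} → f u ≡ f v → M u → M v
  missed-twice⇒closed {u₀} m₀ m_w w∉Q {u} fu≡fv mu with f u ≟ f u₀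
  ... | yes fu≡Q = ¬N⇒M λ nv → N⇒¬M (split⇒N-outside mu nv fu≡fv λ e → w∉Q (trans e fu≡Q)) m_w
  ... | no fu≢Q  = ¬N⇒M λ nv → N⇒¬M (split⇒N-outside mu nv fu≡fv (≢-sym fu≢Q)) m₀

  missed-or-seen : (∀ {u v} → f u ≡ f v → M u → M v) → ∀ {P} → Large P → Missed P ⊎ Seen P
  missed-or-seen closed (a , _ , _ , fa , _) with M? a
  ... | yes ma = inj₁ λ fu → closed (trans fa (sym fu)) ma
  ... | no ¬ma = inj₂ λ fu → ¬M⇒N λ mu → ¬ma (closed (trans fu (sym fa)) mu)

  missed-elsewhere : ∀ {u₀ w} → M u₀ → M w → f w ≢ f u₀ → (P : Fin k) → ∃ λ m → M m × f m ≢ P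
  missed-elsewhere {u₀} {w} m₀ m_w w∉Q P with f u₀ ≟ P
  ... | yes Q≡P = w , m_w , λ fw≡P → w∉Q (trans fw≡P (sym Q≡P))
  ... | no Q≢P  = u₀ , m₀ , Q≢P

  module _ (three-parts : 3 ≤ k) {p q} (p≢q : p ≢ q) (large-p : Large p) (large-q : Large q)
    (x-neighbour : ∃ N) where

    large-part-avoiding : (Q : Fin k) → ∃ λ P → P ≢ Q × Large P
    large-part-avoiding Q with p ≟ Q
    ... | yes refl = q , ≢-sym p≢q , large-q
    ... | no p≢Q   = p , p≢Q , large-p

    split-case : ∀ {u₀ u₁} → M u₀ → N u₁ → f u₁ ≡ f u₀ → ContainsForbidden G
    split-case {u₀} m₀ n₁ fu₁ with large-part-avoiding (f u₀)
    ... | P , P≢Q , large-P with third-element three-parts (f u₀) P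
    ...   | R , R≢Q , R≢P = split⇒forbidden m₀ n₁ fu₁ (λ _ → split⇒N-outside m₀ n₁ (sym fu₁))
                              large-P P≢Q (proj₂ (f-surjective R) refl) R≢Q R≢P

    missed-twice-case : ∀ {u₀ w} → M u₀ → M w → f w ≢ f u₀ → ContainsForbidden G
    missed-twice-case m₀ m_w w∉Q
      with missed-or-seen (missed-twice⇒closed m₀ m_w w∉Q) large-p
         | missed-or-seen (missed-twice⇒closed m₀ m_w w∉Q) large-q
    ... | inj₁ missed-p | inj₁ missed-q =
      missed-missed⇒forbidden large-p large-q p≢q missed-p missed-q (proj₂ x-neighbour)
    ... | inj₁ missed-p | inj₂ seen-q with missed-elsewhere m₀ m_w w∉Q p
    ...   | m , mm , m∉p = missed-seen⇒forbidden large-p large-q p≢q missed-p seen-q mm m∉p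
    missed-twice-case m₀ m_w w∉Q | inj₂ seen-p | inj₁ missed-q with missed-elsewhere m₀ m_w w∉Q q
    ...   | m , mm , m∉q = missed-seen⇒forbidden large-q large-p (≢-sym p≢q) missed-q seen-p mm m∉q
    missed-twice-case m₀ m_w w∉Q | inj₂ seen-p | inj₂ seen-q =
      seen-seen⇒forbidden large-p large-q p≢q seen-p seen-q m₀ m_w w∉Q

    classification : IsCompleteMultipartite G ⊎ ContainsForbidden G
    classification with any? M?
    ... | no no-missed = inj₁ (universal⇒cm λ u → ¬M⇒N λ mu → no-missed (u , mu))
    ... | yes (u₀ , m₀) with any? (λ u → (f u ≟ f u₀) ×-dec N? u)
    ...   | yes (u₁ , fu₁ , n₁) = inj₂ (split-case m₀ n₁ fu₁)
    ...   | no unsplit with any? (λ w → ¬? (f w ≟ f u₀) ×-dec M? w)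
    ...     | yes (w , w∉Q , m_w) = inj₂ (missed-twice-case m₀ m_w w∉Q)
    ...     | no confined = inj₁ (joins-part⇒cm (f u₀) λ u → mk⇔
                (λ nu Q≡fu → unsplit (u , sym Q≡fu , nu))
                (λ Q≢fu → ¬M⇒N λ mu → confined (u , ≢-sym Q≢fu , mu)))

cm-or-forbidden⇒exactly-one : ∀ {n} {G : Graph n} →
  IsCompleteMultipartite G ⊎ ContainsForbidden G →
  (IsCompleteMultipartite G × ¬ ContainsForbidden G) ⊎ (¬ IsCompleteMultipartite G × ContainsForbidden G)
cm-or-forbidden⇒exactly-one (inj₁ cm)        = inj₁ (cm , λ forbidden → forbidden⇒¬cm forbidden cm)
cm-or-forbidden⇒exactly-one (inj₂ forbidden) = inj₂ (forbidden⇒¬cm forbidden , forbidden)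

lemma10 : (n : ℕ) (H : Graph n) (H' : Graph (suc n)) (x : Fin (suc n)) →
    IsSimple H → IsLemma10Host H →
    IsSimple H' → IsCograph H' → Connected H' →
    (∀ u v → H' (punchIn x u) (punchIn x v) ≡ H u v) →
    (IsCompleteMultipartite H' × ¬ ContainsForbidden H')
      ⊎ (¬ IsCompleteMultipartite H' × ContainsForbidden H')
lemma10 n H H' x _ (k , f , (f-surjective , partition) , three-parts , p , q , p≢q , large-p , large-q)
  H'-simple cograph connected restricts =
  cm-or-forbidden⇒exactly-one
    (classification three-parts p≢q large-p large-q (x-has-neighbour connected (proj₁ large-p)))
  where
  open Extension x H'-simple cograph f-surjective
    (λ u v → subst (λ b → (b ≡ true) ⇔ (f u ≢ f v)) (sym (restricts u v)) (partition u v))
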